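{- Let $J=\{(2n+1)2^{2k}-1 \mid n,k\in\mathbb{N}\}$, where $\mathbb{N}=\{0,1,2,\ldots\}$. For an integer $m\ge 1$ let $\mathrm{Sym}_m$ denote the set of permutations of $\{0,1,\ldots,m-1\}$. (J1) For every integer $m\ge 1$, the number of permutations $\sigma\in\mathrm{Sym}_m$ such that $i+\sigma(i)\in J$ for all $i=0,1,\ldots,m-1$ is odd. (J2) For every integer $m\ge 1$, the number of permutations $\sigma\in\mathrm{Sym}_m$ such that $i+\sigma(i)\in J$ for all $i=0,1,\ldots,m-2$ (no condition on $i=m-1$) is odd.
   Context: $\mathbb{N}$ denotes the set of non-negative integers. Thus $J=\{0,2,3,4,6,8,10,11,\ldots\}$. -}

module Defs where

open import Data.Nat using (ℕ; _+_; _*_; _∸_; _^_)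
open import Data.Fin using (Fin)
open import Data.List using (List; length)
open import Data.List.Relation.Unary.All using (All)
open import Data.List.Relation.Unary.Any using (Any)
open import Data.List.Relation.Unary.AllPairs using (AllPairs)
open import Data.Product using (Σ; ∃; ∃₂; _×_)
open import Relation.Nullary using (¬_)
open import Relation.Binary.PropositionalEquality using (_≡_; _≗_)
open import Function.Definitions using (Bijective)

J : ℕ → Set
J x = ∃₂ λ n k → x ≡ (2 * n + 1) * 2 ^ (2 * k) ∸ 1

-- Sym_m : permutations of {0,…,m-1} = Fin m, i.e. bijections Fin m → Fin m
-- (two permutations are the same iff they agree pointwise)
IsPerm : (m : ℕ) → (Fin m → Fin m) → Set
IsPerm m σ = Bijective _≡_ _≡_ σ

Odd : ℕ → Set
Odd N = ∃ λ k → N ≡ 1 + 2 * k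

-- "The set of functions Fin m → Fin m (up to pointwise equality) satisfying P
--  has exactly N elements": witnessed by a duplicate-free complete list.
CountIs : (m : ℕ) → ((Fin m → Fin m) → Set) → ℕ → Set
CountIs m P N =
  Σ (List (Fin m → Fin m)) λ l →
    (length l ≡ N)
    × All P l
    × (∀ σ → P σ → Any (λ τ → σ ≗ τ) l)
    × AllPairs (λ σ τ → ¬ (σ ≗ τ)) l

module Submission where

-- Let a(s) = 1 if s ∈ J and 0 otherwise. Enumerating the permutations σ with a(i + σ i) = 1 along the
-- row expansion of a permanent shows that their number is odd iff the permanent over GF(2) of the
-- Hankel matrix H_m = (a(i + j))_{i,j<m} is 1; for (J2) the last row of H_m is replaced by ones
-- (the matrix H⁺_{m-1}). Since s + 1 = (2n+1)·2^e with e even exactly when s ∈ J, we have a(2k) = 1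
-- and a(2k+1) = 1 - a(k). Hence the complement 1 - H vanishes on the even×even and odd×odd blocks and
-- its mixed blocks are again Hankel matrices of a, of half the size. Writing every row of H as the
-- corresponding row of 1 - H plus the all-ones row and expanding (two all-ones rows contribute 0 mod 2),
-- then ordering rows and columns by parity, everything becomes block triangular:
--   per H_2n = (per H_n)²,  per H_2n+1 = (per H⁺_n)²,
--   per H⁺_2n = per H_n · per H⁺_n,  per H⁺_2n+1 = per H_n+1 · per H⁺_n,
-- and by strong induction all these permanents are 1.

open import Defs
open import Algebra using (CommutativeRing)
open import Data.Bool using (Bool; true; false; not; _∧_; _xor_; if_then_else_)
open import Data.Bool.Properties
  using (not-involutive; not-distribˡ-xor; xor-assoc; xor-comm; xor-same; xor-identityʳ;
         xor-∧-commutativeRing; ∧-assoc; ∧-comm; ∧-zeroʳ; ∧-distribˡ-xor)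
open import Data.Empty using (⊥-elim)
open import Data.Fin using (Fin; toℕ) renaming (zero to fzero; _≟_ to _≟ᶠ_)
open import Data.List
  using (List; []; _∷_; _++_; map; length; concatMap; tabulate; allFin; upTo; downFrom; applyUpTo)
open import Data.List.Properties
  using (map-∘; map-++; map-cong-local; map-tabulate; length-++; length-map; length-downFrom; reverse-upTo)
open import Data.List.Membership.Propositional using (_∈_; lose)
open import Data.List.Membership.Propositional.Properties
  using (∈-∃++; ∈-allFin; ∈-map⁺; ∈-map⁻; ∈-downFrom⁻)
open import Data.List.Relation.Unary.All as All using (All; []; _∷_)
import Data.List.Relation.Unary.All.Properties as Allₚ
open import Data.List.Relation.Unary.Any as Any using (Any; here; there)
import Data.List.Relation.Unary.Any.Properties as Anyₚ
open import Data.List.Relation.Unary.AllPairs as AllPairs using (AllPairs; []; _∷_)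
import Data.List.Relation.Unary.AllPairs.Properties as AllPairsₚ
open import Data.List.Relation.Unary.Unique.Propositional using (Unique)
open import Data.List.Relation.Unary.Unique.Propositional.Properties using (allFin⁺)
open import Data.List.Relation.Binary.Permutation.Propositional as ↭
  using (_↭_; ↭-sym; ↭-reflexive; ↭⇒↭ₛ)
open import Data.List.Relation.Binary.Permutation.Propositional.Properties
  using (All-resp-↭; ∈-resp-↭; ↭-length; ↭-reverse; shift; ++-comm) renaming (map⁺ to ↭-map⁺)
import Data.List.Relation.Binary.Permutation.Setoid.Properties as ↭ₛ
open import Data.Maybe as Maybe using (Maybe; just; nothing)
open import Data.Nat using (ℕ; zero; suc; _+_; _*_; _∸_; _^_; _≤_; _<_; s≤s; s≤s⁻¹; z<s)
open import Data.Nat.Induction using (<-rec)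
open import Data.Nat.Properties
  using (suc-injective; +-suc; +-comm; *-suc; *-identityʳ; *-assoc; *-comm; *-distribˡ-+; *-cancelˡ-≡;
         even≢odd; m≤m+n; m<m+n; n<1+n; ≤-trans; <-irrefl; _<?_)
open import Data.Product using (∃; ∃₂; _×_; _,_; proj₁; proj₂; map₂)
open import Function using (_∘_; id; flip; const)
open import Relation.Nullary using (¬_; yes; no)
open import Relation.Binary.Definitions using (DecidableEquality)
open import Relation.Binary.PropositionalEquality
  using (_≡_; _≢_; refl; sym; trans; cong; cong₂; subst; subst₂; setoid; module ≡-Reasoning)
open import Algebra.Properties.CommutativeSemigroup
  (CommutativeRing.+-commutativeSemigroup xor-∧-commutativeRing) using (interchange)

open ≡-Reasoning

private variable
  A B C D : Set

-- Sums over GF(2)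

xorSum : List A → (A → Bool) → Bool
xorSum []       f = false
xorSum (x ∷ xs) f = f x xor xorSum xs f

syntax xorSum xs (λ x → e) = ⨁[ x ← xs ] e

module _ {f g : A → Bool} where

  xorSum-congᴬ : ∀ {xs} → All (λ x → f x ≡ g x) xs → xorSum xs f ≡ xorSum xs g
  xorSum-congᴬ []         = refl
  xorSum-congᴬ (eq ∷ eqs) = cong₂ _xor_ eq (xorSum-congᴬ eqs)

  xorSum-cong : ∀ xs → (∀ x → f x ≡ g x) → xorSum xs f ≡ xorSum xs g
  xorSum-cong []       f≗g = refl
  xorSum-cong (x ∷ xs) f≗g = cong₂ _xor_ (f≗g x) (xorSum-cong xs f≗g)

module _ {f : A → Bool} where

  xorSum-falseᴬ : ∀ {xs} → All (λ x → f x ≡ false) xs → xorSum xs f ≡ false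
  xorSum-falseᴬ []         = refl
  xorSum-falseᴬ (eq ∷ eqs) = cong₂ _xor_ eq (xorSum-falseᴬ eqs)

  xorSum-false : ∀ xs → (∀ x → f x ≡ false) → xorSum xs f ≡ false
  xorSum-false []       f≡false = refl
  xorSum-false (x ∷ xs) f≡false = cong₂ _xor_ (f≡false x) (xorSum-false xs f≡false)

xorSum-map : ∀ (h : A → B) xs (f : B → Bool) → xorSum (map h xs) f ≡ xorSum xs (f ∘ h)
xorSum-map h []       f = refl
xorSum-map h (x ∷ xs) f = cong (f (h x) xor_) (xorSum-map h xs f)

xorSum-xor : ∀ (xs : List A) f g →
  (⨁[ x ← xs ] (f x xor g x)) ≡ xorSum xs f xor xorSum xs g
xorSum-xor []       f g = refl
xorSum-xor (x ∷ xs) f g =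
  trans (cong ((f x xor g x) xor_) (xorSum-xor xs f g)) (interchange (f x) (g x) _ _)

∧-distribˡ-xorSum : ∀ b (xs : List A) f → b ∧ xorSum xs f ≡ (⨁[ x ← xs ] (b ∧ f x))
∧-distribˡ-xorSum b []       f = ∧-zeroʳ b
∧-distribˡ-xorSum b (x ∷ xs) f =
  trans (∧-distribˡ-xor b (f x) _) (cong (b ∧ f x xor_) (∧-distribˡ-xorSum b xs f))

∧-distribʳ-xorSum : ∀ b (xs : List A) f → xorSum xs f ∧ b ≡ (⨁[ x ← xs ] (f x ∧ b))
∧-distribʳ-xorSum b xs f = begin
  xorSum xs f ∧ b             ≡⟨ ∧-comm _ b ⟩
  b ∧ xorSum xs f             ≡⟨ ∧-distribˡ-xorSum b xs f ⟩
  (⨁[ x ← xs ] (b ∧ f x))     ≡⟨ xorSum-cong xs (λ x → ∧-comm b (f x)) ⟩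
  (⨁[ x ← xs ] (f x ∧ b))     ∎

xorSum-comm : ∀ (xs : List A) (ys : List B) (f : A → B → Bool) →
  (⨁[ x ← xs ] (⨁[ y ← ys ] f x y)) ≡ (⨁[ y ← ys ] (⨁[ x ← xs ] f x y))
xorSum-comm []       ys f = sym (xorSum-false ys λ _ → refl)
xorSum-comm (x ∷ xs) ys f =
  trans (cong (xorSum ys (f x) xor_) (xorSum-comm xs ys f)) (sym (xorSum-xor ys (f x) _))

Unique-resp-↭ : ∀ {xs ys : List A} → xs ↭ ys → Unique xs → Unique ys
Unique-resp-↭ {A = A} xs↭ys = ↭ₛ.Unique-resp-↭ (setoid A) (↭⇒↭ₛ xs↭ys)

select : List A → List (A × List A)
select []       = []
select (x ∷ xs) = (x , xs) ∷ map (map₂ (x ∷_)) (select xs)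

xorSum-select-∷ : ∀ (x : A) xs (f : A × List A → Bool) →
  xorSum (select (x ∷ xs)) f ≡ f (x , xs) xor (⨁[ p ← select xs ] f (proj₁ p , x ∷ proj₂ p))
xorSum-select-∷ x xs f = cong (f (x , xs) xor_) (xorSum-map _ (select xs) f)

xorSum-select-map : ∀ (g : A → B) xs (f : B × List B → Bool) →
  xorSum (select (map g xs)) f ≡ (⨁[ p ← select xs ] f (g (proj₁ p) , map g (proj₂ p)))
xorSum-select-map g []       f = refl
xorSum-select-map g (x ∷ xs) f = begin
  xorSum (select (g x ∷ map g xs)) f
    ≡⟨ xorSum-select-∷ (g x) (map g xs) f ⟩
  f (g x , map g xs) xor (⨁[ p ← select (map g xs) ] f (proj₁ p , g x ∷ proj₂ p))
    ≡⟨ cong (f (g x , map g xs) xor_) (xorSum-select-map g xs _) ⟩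
  f (g x , map g xs) xor (⨁[ p ← select xs ] f (g (proj₁ p) , g x ∷ map g (proj₂ p)))
    ≡⟨ xorSum-select-∷ x xs (λ p → f (g (proj₁ p) , map g (proj₂ p))) ⟨
  (⨁[ p ← select (x ∷ xs) ] f (g (proj₁ p) , map g (proj₂ p))) ∎

xorSum-select-++ : ∀ (xs ys : List A) f →
  xorSum (select (xs ++ ys)) f ≡
    (⨁[ p ← select xs ] f (proj₁ p , proj₂ p ++ ys)) xor (⨁[ q ← select ys ] f (proj₁ q , xs ++ proj₂ q))
xorSum-select-++ []       ys f = refl
xorSum-select-++ (x ∷ xs) ys f = begin
  xorSum (select (x ∷ xs ++ ys)) f
    ≡⟨ xorSum-select-∷ x (xs ++ ys) f ⟩
  f (x , xs ++ ys) xor (⨁[ p ← select (xs ++ ys) ] f (proj₁ p , x ∷ proj₂ p))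
    ≡⟨ cong (f (x , xs ++ ys) xor_) (xorSum-select-++ xs ys _) ⟩
  f (x , xs ++ ys) xor (L xor R)
    ≡⟨ xor-assoc (f (x , xs ++ ys)) L R ⟨
  (f (x , xs ++ ys) xor L) xor R
    ≡⟨ cong (_xor R) (xorSum-select-∷ x xs (λ p → f (proj₁ p , proj₂ p ++ ys))) ⟨
  (⨁[ p ← select (x ∷ xs) ] f (proj₁ p , proj₂ p ++ ys)) xor R ∎
  where
  L R : Bool
  L = ⨁[ p ← select xs ] f (proj₁ p , x ∷ proj₂ p ++ ys)
  R = ⨁[ q ← select ys ] f (proj₁ q , x ∷ xs ++ proj₂ q)

select-↭ : ∀ (xs : List A) → All (λ p → proj₁ p ∷ proj₂ p ↭ xs) (select xs)
select-↭ []       = []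
select-↭ (x ∷ xs) =
  ↭.refl ∷ Allₚ.map⁺ (All.map (λ p↭ → ↭.trans (↭.swap _ _ ↭.refl) (↭.prep x p↭)) (select-↭ xs))

select-All : ∀ {P : A → Set} {xs} → All P xs → All (λ p → All P (proj₁ p ∷ proj₂ p)) (select xs)
select-All {xs = xs} Pxs = All.map (λ p↭ → All-resp-↭ (↭-sym p↭) Pxs) (select-↭ xs)

select-Unique : ∀ {xs : List A} → Unique xs → All (λ p → Unique (proj₁ p ∷ proj₂ p)) (select xs)
select-Unique {xs = xs} u = All.map (λ p↭ → Unique-resp-↭ (↭-sym p↭) u) (select-↭ xs)

map-proj₁-select : ∀ (xs : List A) → map proj₁ (select xs) ≡ xs
map-proj₁-select []       = refl
map-proj₁-select (x ∷ xs) = cong (x ∷_) (trans (sym (map-∘ (select xs))) (map-proj₁-select xs))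

select-Unique-chosen : ∀ {xs : List A} → Unique xs → AllPairs (λ p q → proj₁ p ≢ proj₁ q) (select xs)
select-Unique-chosen {xs = xs} u =
  AllPairsₚ.map⁻ (subst Unique (sym (map-proj₁-select xs)) u)

select-middle : ∀ (ys : List A) x zs → (x , ys ++ zs) ∈ select (ys ++ x ∷ zs)
select-middle []       x zs = here refl
select-middle (y ∷ ys) x zs = there (Anyₚ.map⁺ (Any.map (cong (map₂ (y ∷_))) (select-middle ys x zs)))

-- Every unordered pair of distinct picks occurs twice.
xorSum-select²-symmetric : ∀ {X : Set} (xs : List X) (F : X → X → List X → Bool) →
  (∀ c d zs → F c d zs ≡ F d c zs) →
  (⨁[ p ← select xs ] (⨁[ q ← select (proj₂ p) ] F (proj₁ p) (proj₁ q) (proj₂ q))) ≡ false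
xorSum-select²-symmetric []       F F-sym = refl
xorSum-select²-symmetric {X} (y ∷ ys) F F-sym = begin
  xorSum (select (y ∷ ys)) (λ p → Inner (proj₁ p) (proj₂ p))
    ≡⟨ xorSum-select-∷ y ys (λ p → Inner (proj₁ p) (proj₂ p)) ⟩
  T xor (⨁[ p ← select ys ] Inner (proj₁ p) (y ∷ proj₂ p))
    ≡⟨ cong (T xor_) (xorSum-cong (select ys) λ p →
         xorSum-select-∷ y (proj₂ p) (λ q → F (proj₁ p) (proj₁ q) (proj₂ q))) ⟩
  T xor (⨁[ p ← select ys ] (F (proj₁ p) y (proj₂ p) xor Rest p))
    ≡⟨ cong (T xor_) (xorSum-xor (select ys) (λ p → F (proj₁ p) y (proj₂ p)) Rest) ⟩
  T xor ((⨁[ p ← select ys ] F (proj₁ p) y (proj₂ p)) xor xorSum (select ys) Rest)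
    ≡⟨ cong (λ z → T xor (z xor xorSum (select ys) Rest)) (xorSum-cong (select ys) λ p → F-sym _ y _) ⟩
  T xor (T xor xorSum (select ys) Rest)
    ≡⟨ xor-assoc T T _ ⟨
  (T xor T) xor xorSum (select ys) Rest
    ≡⟨ cong (_xor xorSum (select ys) Rest) (xor-same T) ⟩
  xorSum (select ys) Rest
    ≡⟨ xorSum-select²-symmetric ys (λ c d zs → F c d (y ∷ zs)) (λ c d zs → F-sym c d (y ∷ zs)) ⟩
  false ∎
  where
  Inner : X → List X → Bool
  Inner c zs = ⨁[ q ← select zs ] F c (proj₁ q) (proj₂ q)
  T : Bool
  T = Inner y ys
  Rest : X × List X → Bool
  Rest p = ⨁[ q ← select (proj₂ p) ] F (proj₁ p) (proj₁ q) (y ∷ proj₂ q)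

-- Permanents over GF(2)

per : (A → B → Bool) → List A → List B → Bool
per R []       []      = true
per R []       (_ ∷ _) = false
per R (r ∷ rs) cs      = ⨁[ p ← select cs ] (R r (proj₁ p) ∧ per R rs (proj₂ p))

per-cong : ∀ {R S : A → B → Bool} → (∀ x y → R x y ≡ S x y) → ∀ rs cs → per R rs cs ≡ per S rs cs
per-cong R≗S []       []      = refl
per-cong R≗S []       (_ ∷ _) = refl
per-cong R≗S (r ∷ rs) cs      =
  xorSum-cong (select cs) λ p → cong₂ _∧_ (R≗S r (proj₁ p)) (per-cong R≗S rs (proj₂ p))

per-map-rows : ∀ (R : A → B → Bool) (f : C → A) rs cs → per R (map f rs) cs ≡ per (R ∘ f) rs cs
per-map-rows R f []       []      = refl
per-map-rows R f []       (_ ∷ _) = refl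
per-map-rows R f (r ∷ rs) cs      =
  xorSum-cong (select cs) λ p → cong (R (f r) (proj₁ p) ∧_) (per-map-rows R f rs (proj₂ p))

per-map-cols : ∀ (R : A → B → Bool) (g : C → B) rs cs →
  per R rs (map g cs) ≡ per (λ x y → R x (g y)) rs cs
per-map-cols R g []       []      = refl
per-map-cols R g []       (_ ∷ _) = refl
per-map-cols R g (r ∷ rs) cs      = trans (xorSum-select-map g cs _)
  (xorSum-cong (select cs) λ p → cong (R r (g (proj₁ p)) ∧_) (per-map-cols R g rs (proj₂ p)))

per-reindex : ∀ {R : A → B → Bool} {S : C → D → Bool} (f : C → A) (g : D → B) →
  (∀ x y → R (f x) (g y) ≡ S x y) → ∀ rs cs → per R (map f rs) (map g cs) ≡ per S rs cs
per-reindex {R = R} f g R∘f∘g≗S rs cs = begin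
  per R (map f rs) (map g cs)           ≡⟨ per-map-rows R f rs (map g cs) ⟩
  per (R ∘ f) rs (map g cs)             ≡⟨ per-map-cols (R ∘ f) g rs cs ⟩
  per (λ x y → R (f x) (g y)) rs cs     ≡⟨ per-cong R∘f∘g≗S rs cs ⟩
  per _ rs cs                           ∎

per-∷-∷ : ∀ (R : A → B → Bool) r₁ r₂ rs cs → per R (r₁ ∷ r₂ ∷ rs) cs ≡
  (⨁[ p ← select cs ] (⨁[ q ← select (proj₂ p) ] ((R r₁ (proj₁ p) ∧ R r₂ (proj₁ q)) ∧ per R rs (proj₂ q))))
per-∷-∷ R r₁ r₂ rs cs = xorSum-cong (select cs) λ p →
  trans (∧-distribˡ-xorSum (R r₁ (proj₁ p)) (select (proj₂ p)) _)
        (xorSum-cong (select (proj₂ p)) λ q → sym (∧-assoc (R r₁ (proj₁ p)) _ _))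

per-repeated-row : ∀ (R : A → B → Bool) r rs cs → per R (r ∷ r ∷ rs) cs ≡ false
per-repeated-row R r rs cs = trans (per-∷-∷ R r r rs cs)
  (xorSum-select²-symmetric cs (λ c d zs → (R r c ∧ R r d) ∧ per R rs zs)
    λ c d zs → cong (_∧ per R rs zs) (∧-comm (R r c) (R r d)))

per-swap-rows : ∀ (R : A → B → Bool) r₁ r₂ rs cs → per R (r₁ ∷ r₂ ∷ rs) cs ≡ per R (r₂ ∷ r₁ ∷ rs) cs
per-swap-rows {B = B} R r₁ r₂ rs cs = xor-≡false⇒≡ (begin
  per R (r₁ ∷ r₂ ∷ rs) cs xor per R (r₂ ∷ r₁ ∷ rs) cs
    ≡⟨ cong₂ _xor_ (per-∷-∷ R r₁ r₂ rs cs) (per-∷-∷ R r₂ r₁ rs cs) ⟩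
  xorSum (select cs) (Both F) xor xorSum (select cs) (Both F′)
    ≡⟨ xorSum-xor (select cs) (Both F) (Both F′) ⟨
  (⨁[ p ← select cs ] (Both F p xor Both F′ p))
    ≡⟨ xorSum-cong (select cs) (λ p → xorSum-xor (select (proj₂ p)) _ _) ⟨
  (⨁[ p ← select cs ] (⨁[ q ← select (proj₂ p) ] (F (proj₁ p) (proj₁ q) (proj₂ q) xor F′ (proj₁ p) (proj₁ q) (proj₂ q))))
    ≡⟨ xorSum-select²-symmetric cs (λ c d zs → F c d zs xor F′ c d zs) F⊕F′-sym ⟩
  false ∎)
  where
  F F′ : B → B → List B → Bool
  F  c d zs = (R r₁ c ∧ R r₂ d) ∧ per R rs zs
  F′ c d zs = (R r₂ c ∧ R r₁ d) ∧ per R rs zs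
  Both : (B → B → List B → Bool) → B × List B → Bool
  Both G p = ⨁[ q ← select (proj₂ p) ] G (proj₁ p) (proj₁ q) (proj₂ q)
  F⊕F′-sym : ∀ c d zs → F c d zs xor F′ c d zs ≡ F d c zs xor F′ d c zs
  F⊕F′-sym c d zs = trans (xor-comm (F c d zs) _)
    (cong₂ _xor_ (cong (_∧ per R rs zs) (∧-comm (R r₂ c) (R r₁ d)))
                 (cong (_∧ per R rs zs) (∧-comm (R r₁ c) (R r₂ d))))
  xor-≡false⇒≡ : ∀ {x y} → x xor y ≡ false → x ≡ y
  xor-≡false⇒≡ {false} {false} _ = refl
  xor-≡false⇒≡ {true}  {true}  _ = refl

per-↭-rows : ∀ (R : A → B → Bool) {rs rs′} → rs ↭ rs′ → ∀ cs → per R rs cs ≡ per R rs′ cs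
per-↭-rows R ↭.refl                  cs = refl
per-↭-rows R (↭.prep r rs↭)          cs =
  xorSum-cong (select cs) λ p → cong (R r (proj₁ p) ∧_) (per-↭-rows R rs↭ (proj₂ p))
per-↭-rows R (↭.swap {xs = rs} r₁ r₂ rs↭) cs = trans (per-swap-rows R r₁ r₂ rs cs)
  (xorSum-cong (select cs) λ p → cong (R r₂ (proj₁ p) ∧_)
    (xorSum-cong (select (proj₂ p)) λ q → cong (R r₁ (proj₁ q) ∧_) (per-↭-rows R rs↭ (proj₂ q))))
per-↭-rows R (↭.trans rs↭ rs↭′)      cs = trans (per-↭-rows R rs↭ cs) (per-↭-rows R rs↭′ cs)

per-expand-col : ∀ (R : A → B → Bool) rs c cs →
  per R rs (c ∷ cs) ≡ (⨁[ q ← select rs ] (R (proj₁ q) c ∧ per R (proj₂ q) cs))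
per-expand-col R []       c cs = refl
per-expand-col R (r ∷ rs) c cs = begin
  xorSum (select (c ∷ cs)) (λ p → R r (proj₁ p) ∧ per R rs (proj₂ p))
    ≡⟨ xorSum-select-∷ c cs (λ p → R r (proj₁ p) ∧ per R rs (proj₂ p)) ⟩
  R r c ∧ per R rs cs xor (⨁[ p ← select cs ] (R r (proj₁ p) ∧ per R rs (c ∷ proj₂ p)))
    ≡⟨ cong (R r c ∧ per R rs cs xor_) (xorSum-cong (select cs) λ p →
         trans (cong (R r (proj₁ p) ∧_) (per-expand-col R rs c (proj₂ p)))
               (∧-distribˡ-xorSum (R r (proj₁ p)) (select rs) _)) ⟩
  R r c ∧ per R rs cs xor (⨁[ p ← select cs ] (⨁[ q ← select rs ] (R r (proj₁ p) ∧ (R (proj₁ q) c ∧ per R (proj₂ q) (proj₂ p)))))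
    ≡⟨ cong (R r c ∧ per R rs cs xor_) (xorSum-comm (select cs) (select rs) _) ⟩
  R r c ∧ per R rs cs xor (⨁[ q ← select rs ] (⨁[ p ← select cs ] (R r (proj₁ p) ∧ (R (proj₁ q) c ∧ per R (proj₂ q) (proj₂ p)))))
    ≡⟨ cong (R r c ∧ per R rs cs xor_) (xorSum-cong (select rs) λ q →
         trans (xorSum-cong (select cs) λ p → ∧-left-comm (R r (proj₁ p)) (R (proj₁ q) c) _)
               (sym (∧-distribˡ-xorSum (R (proj₁ q) c) (select cs) _))) ⟩
  R r c ∧ per R rs cs xor (⨁[ q ← select rs ] (R (proj₁ q) c ∧ per R (r ∷ proj₂ q) cs))
    ≡⟨ xorSum-select-∷ r rs (λ q → R (proj₁ q) c ∧ per R (proj₂ q) cs) ⟨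
  (⨁[ q ← select (r ∷ rs) ] (R (proj₁ q) c ∧ per R (proj₂ q) cs)) ∎
  where
  ∧-left-comm : ∀ x y z → x ∧ (y ∧ z) ≡ y ∧ (x ∧ z)
  ∧-left-comm x y z = trans (sym (∧-assoc x y z)) (trans (cong (_∧ z) (∧-comm x y)) (∧-assoc y x z))

per-transpose : ∀ (R : A → B → Bool) rs cs → per R rs cs ≡ per (flip R) cs rs
per-transpose R []       []       = refl
per-transpose R []       (c ∷ cs) = refl
per-transpose R (r ∷ rs) cs       = trans
  (xorSum-cong (select cs) λ p → cong (R r (proj₁ p) ∧_) (per-transpose R rs (proj₂ p)))
  (sym (per-expand-col (flip R) cs r rs))

per-↭ : ∀ (R : A → B → Bool) {rs rs′ cs cs′} → rs ↭ rs′ → cs ↭ cs′ → per R rs cs ≡ per R rs′ cs′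
per-↭ R {rs} {rs′} {cs} {cs′} rs↭ cs↭ = begin
  per R rs cs         ≡⟨ per-↭-rows R rs↭ cs ⟩
  per R rs′ cs        ≡⟨ per-transpose R rs′ cs ⟩
  per (flip R) cs rs′ ≡⟨ per-↭-rows (flip R) cs↭ rs′ ⟩
  per (flip R) cs′ rs′ ≡⟨ per-transpose R rs′ cs′ ⟨
  per R rs′ cs′       ∎

ZeroBlock : (A → B → Bool) → List A → List B → Set
ZeroBlock R rs cs = All (λ r → All (λ c → R r c ≡ false) cs) rs

ZeroBlock-map : ∀ {R : A → B → Bool} (f : C → A) (g : D → B) →
  (∀ x y → R (f x) (g y) ≡ false) → ∀ xs ys → ZeroBlock R (map f xs) (map g ys)
ZeroBlock-map f g R≡false xs ys =
  Allₚ.map⁺ (All.tabulate λ {x} _ → Allₚ.map⁺ (All.tabulate λ {y} _ → R≡false x y))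

per-∷-++-zeroRow : ∀ (R : A → B → Bool) {r} rs cs₁ {cs₂} → All (λ c → R r c ≡ false) cs₂ →
  per R (r ∷ rs) (cs₁ ++ cs₂) ≡ (⨁[ p ← select cs₁ ] (R r (proj₁ p) ∧ per R rs (proj₂ p ++ cs₂)))
per-∷-++-zeroRow R {r} rs cs₁ {cs₂} Rr≡false = begin
  per R (r ∷ rs) (cs₁ ++ cs₂)
    ≡⟨ xorSum-select-++ cs₁ cs₂ _ ⟩
  L xor (⨁[ q ← select cs₂ ] (R r (proj₁ q) ∧ per R rs (cs₁ ++ proj₂ q)))
    ≡⟨ cong (L xor_) (xorSum-falseᴬ (All.map (λ {q} → λ { (Rrq≡false ∷ _) →
         cong (_∧ per R rs (cs₁ ++ proj₂ q)) Rrq≡false }) (select-All Rr≡false))) ⟩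
  L xor false
    ≡⟨ xor-identityʳ L ⟩
  L ∎
  where
  L : Bool
  L = ⨁[ p ← select cs₁ ] (R r (proj₁ p) ∧ per R rs (proj₂ p ++ cs₂))

per-block : ∀ (R : A → B → Bool) rs₁ cs₁ {rs₂ cs₂} → length rs₁ ≡ length cs₁ → ZeroBlock R rs₁ cs₂ →
  per R (rs₁ ++ rs₂) (cs₁ ++ cs₂) ≡ per R rs₁ cs₁ ∧ per R rs₂ cs₂
per-block R []        []      _   _          = refl
per-block R (r ∷ rs₁) cs₁ {rs₂} {cs₂} len (Rr≡false ∷ zeroBlock) = begin
  per R (r ∷ rs₁ ++ rs₂) (cs₁ ++ cs₂)
    ≡⟨ per-∷-++-zeroRow R (rs₁ ++ rs₂) cs₁ Rr≡false ⟩
  (⨁[ p ← select cs₁ ] (R r (proj₁ p) ∧ per R (rs₁ ++ rs₂) (proj₂ p ++ cs₂)))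
    ≡⟨ xorSum-congᴬ (All.map (λ {p} p↭ → cong (R r (proj₁ p) ∧_)
         (per-block R rs₁ (proj₂ p) (suc-injective (trans len (sym (↭-length p↭)))) zeroBlock)) (select-↭ cs₁)) ⟩
  (⨁[ p ← select cs₁ ] (R r (proj₁ p) ∧ (per R rs₁ (proj₂ p) ∧ per R rs₂ cs₂)))
    ≡⟨ xorSum-cong (select cs₁) (λ p → ∧-assoc (R r (proj₁ p)) _ _) ⟨
  (⨁[ p ← select cs₁ ] ((R r (proj₁ p) ∧ per R rs₁ (proj₂ p)) ∧ per R rs₂ cs₂))
    ≡⟨ ∧-distribʳ-xorSum (per R rs₂ cs₂) (select cs₁) _ ⟨
  per R (r ∷ rs₁) cs₁ ∧ per R rs₂ cs₂ ∎

per-block-tall : ∀ (R : A → B → Bool) rs₁ cs₁ {rs₂ cs₂} → length cs₁ < length rs₁ → ZeroBlock R rs₁ cs₂ →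
  per R (rs₁ ++ rs₂) (cs₁ ++ cs₂) ≡ false
per-block-tall R (r ∷ rs₁) cs₁ {rs₂} {cs₂} lt (Rr≡false ∷ zeroBlock) =
  trans (per-∷-++-zeroRow R (rs₁ ++ rs₂) cs₁ Rr≡false)
        (xorSum-falseᴬ (All.map (λ {p} p↭ → trans (cong (R r (proj₁ p) ∧_)
          (per-block-tall R rs₁ (proj₂ p) (subst (_≤ length rs₁) (sym (↭-length p↭)) (s≤s⁻¹ lt)) zeroBlock))
          (∧-zeroʳ _)) (select-↭ cs₁)))

withOnesRow : (A → B → Bool) → Maybe A → B → Bool
withOnesRow R nothing  c = true
withOnesRow R (just r) c = R r c

onesRow∷ : List A → List (Maybe A)
onesRow∷ rs = nothing ∷ map just rs

per-withOnesRow-just : ∀ (R : A → B → Bool) rs cs → per (withOnesRow R) (map just rs) cs ≡ per R rs cs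
per-withOnesRow-just R = per-map-rows (withOnesRow R) just

per-onesRow∷ : ∀ (R : A → B → Bool) rs cs →
  per (withOnesRow R) (onesRow∷ rs) cs ≡ (⨁[ p ← select cs ] per R rs (proj₂ p))
per-onesRow∷ R rs cs = xorSum-cong (select cs) λ p → per-withOnesRow-just R rs (proj₂ p)

ZeroBlock-withOnesRow : ∀ {R : A → B → Bool} {rs cs} → ZeroBlock R rs cs → ZeroBlock (withOnesRow R) (map just rs) cs
ZeroBlock-withOnesRow = Allₚ.map⁺

per-withOnesRow-reindex : ∀ {R : A → B → Bool} {S : C → D → Bool} (f : C → A) (g : D → B) →
  (∀ x y → R (f x) (g y) ≡ S x y) → ∀ rs cs →
  per (withOnesRow R) (onesRow∷ (map f rs)) (map g cs) ≡ per (withOnesRow S) (onesRow∷ rs) cs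
per-withOnesRow-reindex {R = R} {S} f g R∘f∘g≗S rs cs = begin
  per (withOnesRow R) (onesRow∷ (map f rs)) (map g cs)
    ≡⟨ cong (λ rs′ → per (withOnesRow R) (nothing ∷ rs′) (map g cs)) (trans (sym (map-∘ rs)) (map-∘ rs)) ⟩
  per (withOnesRow R) (map (Maybe.map f) (onesRow∷ rs)) (map g cs)
    ≡⟨ per-reindex {R = withOnesRow R} (Maybe.map f) g pointwise (onesRow∷ rs) cs ⟩
  per (withOnesRow S) (onesRow∷ rs) cs ∎
  where
  pointwise : ∀ x y → withOnesRow R (Maybe.map f x) (g y) ≡ withOnesRow S x y
  pointwise nothing  y = refl
  pointwise (just x) y = R∘f∘g≗S x y

onesRow∷-++-↭ˡ : ∀ (xs ys : List A) → onesRow∷ (xs ++ ys) ↭ map just xs ++ onesRow∷ ys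
onesRow∷-++-↭ˡ xs ys = subst (λ zs → nothing ∷ zs ↭ map just xs ++ onesRow∷ ys) (sym (map-++ just xs ys))
  (↭-sym (shift nothing (map just xs) (map just ys)))

onesRow∷-++-↭ʳ : ∀ (xs ys : List A) → onesRow∷ (xs ++ ys) ↭ map just ys ++ onesRow∷ xs
onesRow∷-++-↭ʳ xs ys = subst (λ zs → nothing ∷ zs ↭ map just ys ++ onesRow∷ xs) (sym (map-++ just xs ys))
  (++-comm (onesRow∷ xs) (map just ys))

per-no-rows : ∀ (R S : A → B → Bool) cs → per R [] cs ≡ per S [] cs
per-no-rows R S []      = refl
per-no-rows R S (_ ∷ _) = refl

not-∧ : ∀ b x → not b ∧ x ≡ (b ∧ x) xor x
not-∧ false x = refl
not-∧ true  x = sym (xor-same x)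

per-complement-onesRow : ∀ (R : A → B → Bool) rs cs →
  per (withOnesRow (λ r c → not (R r c))) (onesRow∷ rs) cs ≡ per (withOnesRow R) (onesRow∷ rs) cs
per-complement-onesRow R []       cs =
  xorSum-cong (select cs) λ p → per-no-rows _ _ (proj₂ p)
per-complement-onesRow {A} {B} R (r ∷ rs) cs = begin
  per N (nothing ∷ just r ∷ map just rs) cs
    ≡⟨ per-swap-rows N nothing (just r) (map just rs) cs ⟩
  (⨁[ p ← select cs ] (not (R r (proj₁ p)) ∧ per N (onesRow∷ rs) (proj₂ p)))
    ≡⟨ xorSum-cong (select cs) (λ p → trans (cong (not (R r (proj₁ p)) ∧_) (per-complement-onesRow R rs (proj₂ p)))
                                          (not-∧ (R r (proj₁ p)) _)) ⟩
  (⨁[ p ← select cs ] ((R r (proj₁ p) ∧ per R⁺ (onesRow∷ rs) (proj₂ p)) xor per R⁺ (onesRow∷ rs) (proj₂ p)))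
    ≡⟨ xorSum-xor (select cs) _ _ ⟩
  per R⁺ (just r ∷ onesRow∷ rs) cs xor per R⁺ (nothing ∷ onesRow∷ rs) cs
    ≡⟨ cong (per R⁺ (just r ∷ onesRow∷ rs) cs xor_) (per-repeated-row R⁺ nothing (map just rs) cs) ⟩
  per R⁺ (just r ∷ onesRow∷ rs) cs xor false
    ≡⟨ xor-identityʳ _ ⟩
  per R⁺ (just r ∷ onesRow∷ rs) cs
    ≡⟨ per-swap-rows R⁺ (just r) nothing (map just rs) cs ⟩
  per R⁺ (onesRow∷ (r ∷ rs)) cs ∎
  where
  N R⁺ : Maybe A → B → Bool
  N  = withOnesRow (λ r c → not (R r c))
  R⁺ = withOnesRow R

-- Row r of the complement is row r of R plus the all-ones row; expanding every row this way,
-- the terms with two or more all-ones rows vanish mod 2.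
per-complement : ∀ (R : A → B → Bool) rs cs →
  per (λ r c → not (R r c)) rs cs ≡
    per R rs cs xor (⨁[ q ← select rs ] per (withOnesRow R) (onesRow∷ (proj₂ q)) cs)
per-complement R []       cs = trans (per-no-rows _ R cs) (sym (xor-identityʳ _))
per-complement {A} {B} R (r ∷ rs) cs = begin
  (⨁[ p ← select cs ] (not (R r (proj₁ p)) ∧ per N rs (proj₂ p)))
    ≡⟨ xorSum-cong (select cs) (λ p → trans (cong (not (R r (proj₁ p)) ∧_) (per-complement R rs (proj₂ p)))
                                          (not-∧ (R r (proj₁ p)) _)) ⟩
  (⨁[ p ← select cs ] ((R r (proj₁ p) ∧ (X p xor Y p)) xor (X p xor Y p)))
    ≡⟨ xorSum-xor (select cs) _ _ ⟩
  (⨁[ p ← select cs ] (R r (proj₁ p) ∧ (X p xor Y p))) xor (⨁[ p ← select cs ] (X p xor Y p))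
    ≡⟨ cong₂ _xor_ (trans (xorSum-cong (select cs) λ p → ∧-distribˡ-xor (R r (proj₁ p)) (X p) (Y p))
                          (xorSum-xor (select cs) _ _))
                   (xorSum-xor (select cs) X Y) ⟩
  (per R (r ∷ rs) cs xor (⨁[ p ← select cs ] (R r (proj₁ p) ∧ Y p))) xor (xorSum (select cs) X xor xorSum (select cs) Y)
    ≡⟨ cong₂ (λ u v → (per R (r ∷ rs) cs xor u) xor v) ΣRY (cong₂ _xor_ ΣX ΣY≡false) ⟩
  (per R (r ∷ rs) cs xor S) xor (T xor false)
    ≡⟨ cong ((per R (r ∷ rs) cs xor S) xor_) (xor-identityʳ T) ⟩
  (per R (r ∷ rs) cs xor S) xor T
    ≡⟨ xor-assoc (per R (r ∷ rs) cs) S T ⟩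
  per R (r ∷ rs) cs xor (S xor T)
    ≡⟨ cong (per R (r ∷ rs) cs xor_) (xor-comm S T) ⟩
  per R (r ∷ rs) cs xor (T xor S)
    ≡⟨ cong (per R (r ∷ rs) cs xor_) (xorSum-select-∷ r rs (λ q → per R⁺ (onesRow∷ (proj₂ q)) cs)) ⟨
  per R (r ∷ rs) cs xor (⨁[ q ← select (r ∷ rs) ] per R⁺ (onesRow∷ (proj₂ q)) cs) ∎
  where
  N : A → B → Bool
  N r c = not (R r c)
  R⁺ : Maybe A → B → Bool
  R⁺ = withOnesRow R
  X Y : B × List B → Bool
  X p = per R rs (proj₂ p)
  Y p = ⨁[ q ← select rs ] per R⁺ (onesRow∷ (proj₂ q)) (proj₂ p)
  S T : Bool
  S = ⨁[ q ← select rs ] per R⁺ (onesRow∷ (r ∷ proj₂ q)) cs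
  T = per R⁺ (onesRow∷ rs) cs
  ΣX : xorSum (select cs) X ≡ T
  ΣX = sym (per-onesRow∷ R rs cs)
  ΣY≡false : xorSum (select cs) Y ≡ false
  ΣY≡false = trans (xorSum-comm (select cs) (select rs) _)
    (xorSum-false (select rs) λ q → per-repeated-row R⁺ nothing (map just (proj₂ q)) cs)
  ΣRY : (⨁[ p ← select cs ] (R r (proj₁ p) ∧ Y p)) ≡ S
  ΣRY = begin
    (⨁[ p ← select cs ] (R r (proj₁ p) ∧ Y p))
      ≡⟨ xorSum-cong (select cs) (λ p → ∧-distribˡ-xorSum (R r (proj₁ p)) (select rs) _) ⟩
    (⨁[ p ← select cs ] (⨁[ q ← select rs ] (R r (proj₁ p) ∧ per R⁺ (onesRow∷ (proj₂ q)) (proj₂ p))))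
      ≡⟨ xorSum-comm (select cs) (select rs) _ ⟩
    (⨁[ q ← select rs ] per R⁺ (just r ∷ onesRow∷ (proj₂ q)) cs)
      ≡⟨ xorSum-cong (select rs) (λ q → per-swap-rows R⁺ (just r) nothing (map just (proj₂ q)) cs) ⟩
    S ∎

data EvenOdd : ℕ → Set where
  even : ∀ k → EvenOdd (2 * k)
  odd  : ∀ k → EvenOdd (suc (2 * k))

evenOdd : ∀ n → EvenOdd n
evenOdd zero    = even 0
evenOdd (suc n) with evenOdd n
... | even k = odd k
... | odd  k = subst EvenOdd (*-suc 2 k) (even (suc k))

isOdd : ℕ → Bool
isOdd zero    = false
isOdd (suc n) = not (isOdd n)

isOdd-+ : ∀ m n → isOdd (m + n) ≡ isOdd m xor isOdd n
isOdd-+ zero    n = refl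
isOdd-+ (suc m) n = trans (cong not (isOdd-+ m n)) (not-distribˡ-xor (isOdd m) (isOdd n))

isOdd-length-concatMap : ∀ (f : A → List B) xs →
  isOdd (length (concatMap f xs)) ≡ (⨁[ x ← xs ] isOdd (length (f x)))
isOdd-length-concatMap f []       = refl
isOdd-length-concatMap f (x ∷ xs) = begin
  isOdd (length (f x ++ concatMap f xs))            ≡⟨ cong isOdd (length-++ (f x)) ⟩
  isOdd (length (f x) + length (concatMap f xs))    ≡⟨ isOdd-+ (length (f x)) _ ⟩
  isOdd (length (f x)) xor isOdd (length (concatMap f xs))
    ≡⟨ cong (isOdd (length (f x)) xor_) (isOdd-length-concatMap f xs) ⟩
  (⨁[ y ← x ∷ xs ] isOdd (length (f y)))          ∎

isOdd-2* : ∀ k → isOdd (2 * k) ≡ false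
isOdd-2* zero    = refl
isOdd-2* (suc k) = trans (cong isOdd (*-suc 2 k)) (cong (not ∘ not) (isOdd-2* k))

isOdd⇒Odd : ∀ N → isOdd N ≡ true → Odd N
isOdd⇒Odd N isOddN with evenOdd N
... | odd  k = k , refl
... | even k with () ← trans (sym (isOdd-2* k)) isOddN

-- Counting the permutations supported by a relation

Unique-map⇒injective : ∀ (f : A → B) {xs} → Unique (map f xs) →
  ∀ {x y} → x ∈ xs → y ∈ xs → f x ≡ f y → x ≡ y
Unique-map⇒injective f (_   ∷ _) (here refl) (here refl) _     = refl
Unique-map⇒injective f (fx∉ ∷ _) (here refl) (there y∈) fx≡fy = ⊥-elim (All.lookup fx∉ (∈-map⁺ f y∈) fx≡fy)
Unique-map⇒injective f (fy∉ ∷ _) (there x∈) (here refl) fx≡fy = ⊥-elim (All.lookup fy∉ (∈-map⁺ f x∈) (sym fx≡fy))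
Unique-map⇒injective f (_   ∷ u) (there x∈) (there y∈) fx≡fy = Unique-map⇒injective f u x∈ y∈ fx≡fy

module Matchings {A B : Set} (_≟_ : DecidableEquality A) (default : B) (R : A → B → Bool) where

  _[_↦_] : (A → B) → A → B → A → B
  (f [ r ↦ c ]) x with x ≟ r
  ... | yes _ = c
  ... | no  _ = f x

  [↦]-here : ∀ f r c → (f [ r ↦ c ]) r ≡ c
  [↦]-here f r c with r ≟ r
  ... | yes _  = refl
  ... | no r≢r = ⊥-elim (r≢r refl)

  [↦]-there : ∀ f r c {x} → x ≢ r → (f [ r ↦ c ]) x ≡ f x
  [↦]-there f r c {x} x≢r with x ≟ r
  ... | yes x≡r = ⊥-elim (x≢r x≡r)
  ... | no  _   = refl

  extend : A → B × List B → List (A → B) → List (A → B)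
  extend r p fs = if R r (proj₁ p) then map (_[ r ↦ proj₁ p ]) fs else []

  matchings : List A → List B → List (A → B)
  matchings []       []      = const default ∷ []
  matchings []       (_ ∷ _) = []
  matchings (r ∷ rs) cs      = concatMap (λ p → extend r p (matchings rs (proj₂ p))) (select cs)

  isOdd-length-matchings : ∀ rs cs → isOdd (length (matchings rs cs)) ≡ per R rs cs
  isOdd-length-matchings []       []      = refl
  isOdd-length-matchings []       (_ ∷ _) = refl
  isOdd-length-matchings (r ∷ rs) cs      =
    trans (isOdd-length-concatMap _ (select cs)) (xorSum-cong (select cs) isOdd-length-extend)
    where
    isOdd-length-extend : ∀ p → isOdd (length (extend r p (matchings rs (proj₂ p)))) ≡ R r (proj₁ p) ∧ per R rs (proj₂ p)
    isOdd-length-extend p with R r (proj₁ p)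
    ... | true  = trans (cong isOdd (length-map _ (matchings rs (proj₂ p)))) (isOdd-length-matchings rs (proj₂ p))
    ... | false = refl

  extend-here : ∀ r p fs → All (λ f → f r ≡ proj₁ p) (extend r p fs)
  extend-here r p fs with R r (proj₁ p)
  ... | true  = Allₚ.map⁺ (All.tabulate λ {f} _ → [↦]-here f r (proj₁ p))
  ... | false = []

  IsMatching : List A → List B → (A → B) → Set
  IsMatching rs cs τ = All (λ r → R r (τ r) ≡ true) rs × map τ rs ↭ cs

  matchings-sound : ∀ rs cs → Unique rs → All (IsMatching rs cs) (matchings rs cs)
  matchings-sound []       []      _              = ([] , ↭.refl) ∷ []
  matchings-sound []       (_ ∷ _) _              = []
  matchings-sound (r ∷ rs) cs      (r≢rs ∷ rs!) =
    Allₚ.concat⁺ (Allₚ.map⁺ (All.map (λ {p} → extend-sound p) (select-↭ cs)))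
    where
    extend-sound : ∀ p → proj₁ p ∷ proj₂ p ↭ cs →
                   All (IsMatching (r ∷ rs) cs) (extend r p (matchings rs (proj₂ p)))
    extend-sound (c , cs′) c∷cs′↭cs with R r c in Rrc
    ... | false = []
    ... | true  = Allₚ.map⁺ (All.map matching-[↦] (matchings-sound rs cs′ rs!))
      where
      matching-[↦] : ∀ {f} → IsMatching rs cs′ f → IsMatching (r ∷ rs) cs (f [ r ↦ c ])
      matching-[↦] {f} (Rf , f↭) =
        subst (λ z → R r z ≡ true) (sym ([↦]-here f r c)) Rrc
          ∷ All.zipWith (λ { {x} (r≢x , Rfx) → trans (cong (R x) ([↦]-there f r c (r≢x ∘ sym))) Rfx }) (r≢rs , Rf) ,
        ↭.trans (↭.prep _ (subst (_↭ cs′)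
                  (map-cong-local (All.map (λ r≢x → sym ([↦]-there f r c (r≢x ∘ sym))) r≢rs)) f↭))
                (subst (λ z → z ∷ cs′ ↭ cs) (sym ([↦]-here f r c)) c∷cs′↭cs)

  Differ : List A → (A → B) → (A → B) → Set
  Differ rs σ τ = Any (λ r → σ r ≢ τ r) rs

  Differ-[↦] : ∀ {r c rs} f g → All (r ≢_) rs → Differ rs f g → Differ rs (f [ r ↦ c ]) (g [ r ↦ c ])
  Differ-[↦] {r} {c} f g (r≢x ∷ _) (here fx≢gx) =
    here λ eq → fx≢gx (trans (sym ([↦]-there f r c (r≢x ∘ sym))) (trans eq ([↦]-there g r c (r≢x ∘ sym))))
  Differ-[↦] f g (_ ∷ r≢rs) (there d) = there (Differ-[↦] f g r≢rs d)

  matchings-distinct : ∀ rs cs → Unique rs → Unique cs → AllPairs (Differ rs) (matchings rs cs)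
  matchings-distinct []       []      _ _ = [] ∷ []
  matchings-distinct []       (_ ∷ _) _ _ = []
  matchings-distinct (r ∷ rs) cs (r≢rs ∷ rs!) cs! = AllPairsₚ.concat⁺
    (Allₚ.map⁺ (All.map (λ {p} → within p) (select-Unique cs!)))
    (AllPairsₚ.map⁺ (AllPairs.map (λ {p} {q} → across p q) (select-Unique-chosen cs!)))
    where
    within : ∀ p → Unique (proj₁ p ∷ proj₂ p) → AllPairs (Differ (r ∷ rs)) (extend r p (matchings rs (proj₂ p)))
    within (c , cs′) (_ ∷ cs′!) with R r c
    ... | false = []
    ... | true  = AllPairsₚ.map⁺ (AllPairs.map (λ {f} {g} → there ∘ Differ-[↦] f g r≢rs)
                    (matchings-distinct rs cs′ rs! cs′!))
    across : ∀ p q → proj₁ p ≢ proj₁ q →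
      All (λ f → All (Differ (r ∷ rs) f) (extend r q (matchings rs (proj₂ q)))) (extend r p (matchings rs (proj₂ p)))
    across p q c≢d = All.map (λ fr≡c → All.map (λ gr≡d → here λ fr≡gr → c≢d (trans (sym fr≡c) (trans fr≡gr gr≡d)))
                                         (extend-here r q _))
                             (extend-here r p _)

  matchings-complete : ∀ (σ : A → B) → (∀ {x y} → σ x ≡ σ y → x ≡ y) → ∀ rs cs → Unique rs → Unique cs →
    All (λ r → R r (σ r) ≡ true) rs → All (λ r → σ r ∈ cs) rs → All (λ c → c ∈ map σ rs) cs →
    Any (λ τ → All (λ r → σ r ≡ τ r) rs) (matchings rs cs)
  matchings-complete σ σ-inj []       []       _ _ _ _ _          = here []
  matchings-complete σ σ-inj []       (c ∷ cs) _ _ _ _ (() ∷ _)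
  matchings-complete σ σ-inj (r ∷ rs) cs (r≢rs ∷ rs!) cs! (Rσr ∷ Rσrs) (σr∈cs ∷ σrs∈cs) cs⊆σ[rrs]
    with ∈-∃++ σr∈cs
  ... | ys , zs , refl = Anyₚ.concatMap⁺ _ (lose (select-middle ys (σ r) zs) extended)
    where
    σr∷rest! : Unique (σ r ∷ ys ++ zs)
    σr∷rest! = Unique-resp-↭ (shift (σ r) ys zs) cs!
    σr∉rest : All (σ r ≢_) (ys ++ zs)
    σr∉rest with σr∷rest!
    ... | σr∉ ∷ _ = σr∉
    rest! : Unique (ys ++ zs)
    rest! with σr∷rest!
    ... | _ ∷ u = u
    σrs∈rest : All (λ x → σ x ∈ ys ++ zs) rs
    σrs∈rest = All.zipWith (λ { (r≢x , σx∈cs) → σx∈rest r≢x (∈-resp-↭ (shift (σ r) ys zs) σx∈cs) })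
                           (r≢rs , σrs∈cs)
      where
      σx∈rest : ∀ {x} → r ≢ x → σ x ∈ σ r ∷ ys ++ zs → σ x ∈ ys ++ zs
      σx∈rest r≢x (here σx≡σr) = ⊥-elim (r≢x (sym (σ-inj σx≡σr)))
      σx∈rest r≢x (there σx∈) = σx∈
    rest⊆σrs : All (λ c → c ∈ map σ rs) (ys ++ zs)
    rest⊆σrs = All.tabulate λ c∈ → c∈σrs (All.lookup σr∉rest c∈)
      (All.lookup cs⊆σ[rrs] (∈-resp-↭ (↭-sym (shift (σ r) ys zs)) (there c∈)))
      where
      c∈σrs : ∀ {c} → σ r ≢ c → c ∈ σ r ∷ map σ rs → c ∈ map σ rs
      c∈σrs σr≢c (here c≡σr) = ⊥-elim (σr≢c (sym c≡σr))
      c∈σrs σr≢c (there c∈)  = c∈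
    extended : Any (λ τ → All (λ x → σ x ≡ τ x) (r ∷ rs)) (extend r (σ r , ys ++ zs) (matchings rs (ys ++ zs)))
    extended rewrite Rσr = Anyₚ.map⁺ (Any.map
      (λ {τ} agree → sym ([↦]-here τ r (σ r))
                    ∷ All.zipWith (λ { (r≢x , σx≡τx) → trans σx≡τx (sym ([↦]-there τ r (σ r) (r≢x ∘ sym))) })
                                  (r≢rs , agree))
      (matchings-complete σ σ-inj rs (ys ++ zs) rs! rest! Rσrs σrs∈rest rest⊆σrs))

countMatchings : ∀ m (R : Fin (suc m) → Fin (suc m) → Bool) →
  ∃ λ N → CountIs (suc m) (λ σ → IsPerm (suc m) σ × (∀ i → R i (σ i) ≡ true)) N
        × isOdd N ≡ per R (allFin (suc m)) (allFin (suc m))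
countMatchings m R =
  length L , (L , refl , all-perm , complete , distinct) , isOdd-length-matchings Fins Fins
  where
  open Matchings _≟ᶠ_ fzero R
  Fins : List (Fin (suc m))
  Fins = allFin (suc m)
  L : List (Fin (suc m) → Fin (suc m))
  L = matchings Fins Fins
  matching⇒perm : ∀ {τ} → IsMatching Fins Fins τ → IsPerm (suc m) τ × (∀ i → R i (τ i) ≡ true)
  matching⇒perm {τ} (Rτ , τ↭) = (injective , surjective) , λ i → All.lookup Rτ (∈-allFin i)
    where
    injective : ∀ {x y} → τ x ≡ τ y → x ≡ y
    injective = Unique-map⇒injective τ (Unique-resp-↭ (↭-sym τ↭) (allFin⁺ _)) (∈-allFin _) (∈-allFin _)
    surjective : ∀ y → ∃ λ x → ∀ {z} → z ≡ x → τ z ≡ y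
    surjective y with x , _ , y≡τx ← ∈-map⁻ τ (∈-resp-↭ (↭-sym τ↭) (∈-allFin y)) = x , λ { refl → sym y≡τx }
  all-perm : All (λ τ → IsPerm (suc m) τ × (∀ i → R i (τ i) ≡ true)) L
  all-perm = All.map matching⇒perm (matchings-sound Fins Fins (allFin⁺ _))
  complete : ∀ σ → IsPerm (suc m) σ × (∀ i → R i (σ i) ≡ true) → Any (λ τ → ∀ x → σ x ≡ τ x) L
  complete σ ((injective , surjective) , Rσ) = Any.map (λ agree x → All.lookup agree (∈-allFin x))
    (matchings-complete σ injective Fins Fins (allFin⁺ _) (allFin⁺ _)
      (All.tabulate λ {x} _ → Rσ x) (All.tabulate λ _ → ∈-allFin _)
      (All.tabulate λ {c} _ → let x , σ≡ = surjective c in subst (_∈ map σ Fins) (σ≡ refl) (∈-map⁺ σ (∈-allFin x))))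
  distinct : AllPairs (λ σ τ → ¬ (∀ x → σ x ≡ τ x)) L
  distinct = AllPairs.map (λ differ σ≗τ → let _ , σx≢τx = Any.satisfied differ in σx≢τx (σ≗τ _))
    (matchings-distinct Fins Fins (allFin⁺ _) (allFin⁺ _))

CountIs-cong : ∀ {m} {P Q : (Fin m → Fin m) → Set} {N} →
  (∀ {σ} → P σ → Q σ) → (∀ {σ} → Q σ → P σ) → CountIs m P N → CountIs m Q N
CountIs-cong P⇒Q Q⇒P (l , len , all , complete , distinct) =
  l , len , All.map P⇒Q all , (λ σ → complete σ ∘ Q⇒P) , distinct

oddly-many-matchings : ∀ m (R : Fin (suc m) → Fin (suc m) → Bool) (P : Fin (suc m) → Fin (suc m) → Set) →
  (∀ {i j} → R i j ≡ true → P i j) → (∀ {i j} → P i j → R i j ≡ true) →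
  per R (allFin (suc m)) (allFin (suc m)) ≡ true →
  ∃ λ N → Odd N × CountIs (suc m) (λ σ → IsPerm (suc m) σ × (∀ i → P i (σ i))) N
oddly-many-matchings m R P R⇒P P⇒R per≡true with N , count , isOddN ← countMatchings m R =
  N , isOdd⇒Odd N (trans isOddN per≡true) ,
  CountIs-cong (λ (perm , Rσ) → perm , R⇒P ∘ Rσ) (λ (perm , Pσ) → perm , P⇒R ∘ Pσ) count

-- Membership in J

halve : ℕ → Bool × ℕ
halve zero    = false , 0
halve (suc n) with halve n
... | false , h = true  , h
... | true  , h = false , suc h

halve-even : ∀ k → halve (2 * k) ≡ (false , k)
halve-even zero    = refl
halve-even (suc k) rewrite +-suc k (k + 0) | halve-even k = refl

halve-odd : ∀ k → halve (suc (2 * k)) ≡ (true , k)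
halve-odd k rewrite halve-even k = refl

-- The first argument is a recursion budget.
inJ≤ : ℕ → ℕ → Bool
inJ≤ zero    s = true
inJ≤ (suc f) s with halve s
... | false , _ = true
... | true  , h = not (inJ≤ f h)

inJ : ℕ → Bool
inJ s = inJ≤ (suc s) s

k<1+2k : ∀ k → k < suc (2 * k)
k<1+2k k = s≤s (m≤m+n k (k + 0))

inJ≤-irrelevant : ∀ f g s → s < f → s < g → inJ≤ f s ≡ inJ≤ g s
inJ≤-irrelevant (suc f) (suc g) s (s≤s s≤f) (s≤s s≤g) with evenOdd s
... | even k rewrite halve-even k = refl
... | odd  k rewrite halve-odd k  = cong not (inJ≤-irrelevant f g k
  (≤-trans (k<1+2k k) s≤f) (≤-trans (k<1+2k k) s≤g))

inJ-even : ∀ k → inJ (2 * k) ≡ true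
inJ-even k rewrite halve-even k = refl

inJ-odd : ∀ k → inJ (suc (2 * k)) ≡ not (inJ k)
inJ-odd k rewrite halve-odd k = cong not (inJ≤-irrelevant (suc (2 * k)) (suc k) k (k<1+2k k) (n<1+n k))

oddTimes2^ : ℕ → ℕ → ℕ
oddTimes2^ n e = (2 * n + 1) * 2 ^ e

oddTimes2^-zero : ∀ n → oddTimes2^ n 0 ≡ suc (2 * n)
oddTimes2^-zero n = trans (*-identityʳ (2 * n + 1)) (+-comm (2 * n) 1)

oddTimes2^-suc : ∀ n e → oddTimes2^ n (suc e) ≡ 2 * oddTimes2^ n e
oddTimes2^-suc n e = begin
  (2 * n + 1) * (2 * 2 ^ e)   ≡⟨ *-assoc (2 * n + 1) 2 (2 ^ e) ⟨
  ((2 * n + 1) * 2) * 2 ^ e   ≡⟨ cong (_* 2 ^ e) (*-comm (2 * n + 1) 2) ⟩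
  (2 * (2 * n + 1)) * 2 ^ e   ≡⟨ *-assoc 2 (2 * n + 1) (2 ^ e) ⟩
  2 * oddTimes2^ n e          ∎

oddTimes2^-exponent-unique : ∀ n m e f → oddTimes2^ n e ≡ oddTimes2^ m f → e ≡ f
oddTimes2^-exponent-unique n m zero    zero    eq = refl
oddTimes2^-exponent-unique n m zero    (suc f) eq =
  ⊥-elim (even≢odd (oddTimes2^ m f) n (trans (sym (oddTimes2^-suc m f)) (trans (sym eq) (oddTimes2^-zero n))))
oddTimes2^-exponent-unique n m (suc e) zero    eq =
  ⊥-elim (even≢odd (oddTimes2^ n e) m (trans (sym (oddTimes2^-suc n e)) (trans eq (oddTimes2^-zero m))))
oddTimes2^-exponent-unique n m (suc e) (suc f) eq = cong suc (oddTimes2^-exponent-unique n m e f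
  (*-cancelˡ-≡ _ _ 2 (trans (sym (oddTimes2^-suc n e)) (trans eq (oddTimes2^-suc m f)))))

suc-pred-oddTimes2^ : ∀ n e → suc (oddTimes2^ n e ∸ 1) ≡ oddTimes2^ n e
suc-pred-oddTimes2^ n zero    rewrite oddTimes2^-zero n = refl
suc-pred-oddTimes2^ n (suc e) rewrite oddTimes2^-suc n e | sym (suc-pred-oddTimes2^ n e) = refl

Pow2Parity : Bool → ℕ → Set
Pow2Parity true  y = ∃₂ λ n k → y ≡ oddTimes2^ n (2 * k)
Pow2Parity false y = ∃₂ λ n k → y ≡ oddTimes2^ n (suc (2 * k))

Pow2Parity-functional : ∀ {b c y} → Pow2Parity b y → Pow2Parity c y → b ≡ c
Pow2Parity-functional {true}  {true}  _ _ = refl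
Pow2Parity-functional {false} {false} _ _ = refl
Pow2Parity-functional {true}  {false} (n , k , eq) (m , j , eq′) =
  ⊥-elim (even≢odd k j (oddTimes2^-exponent-unique n m _ _ (trans (sym eq) eq′)))
Pow2Parity-functional {false} {true}  (n , k , eq) (m , j , eq′) =
  ⊥-elim (even≢odd j k (oddTimes2^-exponent-unique m n _ _ (trans (sym eq′) eq)))

Pow2Parity-double : ∀ b y → Pow2Parity b y → Pow2Parity (not b) (2 * y)
Pow2Parity-double true  y (n , k , refl) = n , k , sym (oddTimes2^-suc n (2 * k))
Pow2Parity-double false y (n , k , refl) =
  n , suc k , trans (sym (oddTimes2^-suc n (suc (2 * k)))) (cong (oddTimes2^ n) (sym (*-suc 2 k)))

Pow2Parity-inJ : ∀ x → Pow2Parity (inJ x) (suc x)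
Pow2Parity-inJ = <-rec _ step
  where
  step : ∀ x → (∀ {y} → y < x → Pow2Parity (inJ y) (suc y)) → Pow2Parity (inJ x) (suc x)
  step x rec with evenOdd x
  ... | even k = subst (λ b → Pow2Parity b (suc (2 * k))) (sym (inJ-even k)) (k , 0 , sym (oddTimes2^-zero k))
  ... | odd  k = subst₂ Pow2Parity (sym (inJ-odd k)) (*-suc 2 k) (Pow2Parity-double (inJ k) (suc k) (rec (k<1+2k k)))

J⇒inJ : ∀ x → J x → inJ x ≡ true
J⇒inJ x (n , k , eq) = Pow2Parity-functional (Pow2Parity-inJ x) (n , k , trans (cong suc eq) (suc-pred-oddTimes2^ n (2 * k)))

inJ⇒J : ∀ x → inJ x ≡ true → J x
inJ⇒J x inJx with n , k , eq ← subst (λ b → Pow2Parity b (suc x)) inJx (Pow2Parity-inJ x) = n , k , cong (_∸ 1) eq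

-- The Hankel matrix of J

H Hᶜ : ℕ → ℕ → Bool
H  i j = inJ (i + j)
Hᶜ i j = not (H i j)

H≡not-Hᶜ : ∀ i j → H i j ≡ not (Hᶜ i j)
H≡not-Hᶜ i j = sym (not-involutive (H i j))

Hᶜ-comm : ∀ i j → Hᶜ i j ≡ Hᶜ j i
Hᶜ-comm i j = cong (not ∘ inJ) (+-comm i j)

Hᶜ-even-even : ∀ p q → Hᶜ (2 * p) (2 * q) ≡ false
Hᶜ-even-even p q = cong not (trans (cong inJ (sym (*-distribˡ-+ 2 p q))) (inJ-even (p + q)))

Hᶜ-odd-odd : ∀ p q → Hᶜ (suc (2 * p)) (suc (2 * q)) ≡ false
Hᶜ-odd-odd p q = cong not (trans (cong inJ sum≡) (inJ-even (suc (p + q))))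
  where
  sum≡ : suc (2 * p) + suc (2 * q) ≡ 2 * suc (p + q)
  sum≡ = trans (cong suc (trans (+-suc (2 * p) (2 * q)) (cong suc (sym (*-distribˡ-+ 2 p q)))))
               (sym (*-suc 2 (p + q)))

Hᶜ-odd-even : ∀ p q → Hᶜ (suc (2 * p)) (2 * q) ≡ H p q
Hᶜ-odd-even p q = begin
  not (inJ (suc (2 * p + 2 * q)))  ≡⟨ cong (not ∘ inJ ∘ suc) (sym (*-distribˡ-+ 2 p q)) ⟩
  not (inJ (suc (2 * (p + q))))    ≡⟨ cong not (inJ-odd (p + q)) ⟩
  not (not (H p q))                ≡⟨ not-involutive (H p q) ⟩
  H p q                            ∎

Hᶜ-even-odd : ∀ p q → Hᶜ (2 * p) (suc (2 * q)) ≡ H p q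
Hᶜ-even-odd p q = trans (Hᶜ-comm (2 * p) (suc (2 * q))) (trans (Hᶜ-odd-even q p) (cong inJ (+-comm q p)))

evens odds : ℕ → List ℕ
evens n = map (2 *_) (downFrom n)
odds  n = map (suc ∘ (2 *_)) (downFrom n)

length-evens : ∀ n → length (evens n) ≡ n
length-evens n = trans (length-map _ (downFrom n)) (length-downFrom n)

length-odds : ∀ n → length (odds n) ≡ n
length-odds n = trans (length-map _ (downFrom n)) (length-downFrom n)

length-evens≡length-odds : ∀ n → length (evens n) ≡ length (odds n)
length-evens≡length-odds n = trans (length-evens n) (sym (length-odds n))

downFrom-2* : ∀ n → downFrom (2 * n) ↭ evens n ++ odds n
downFrom-1+2* : ∀ n → downFrom (suc (2 * n)) ↭ evens (suc n) ++ odds n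

downFrom-2* zero    = ↭.refl
downFrom-2* (suc n) = subst (λ m → downFrom m ↭ evens (suc n) ++ odds (suc n)) (sym (*-suc 2 n))
  (↭.trans (↭.prep (suc (2 * n)) (downFrom-1+2* n))
  (↭.trans (↭.swap (suc (2 * n)) (2 * n) ↭.refl)
           (↭.prep (2 * n) (↭-sym (shift (suc (2 * n)) (evens n) (odds n))))))

downFrom-1+2* n = ↭.prep (2 * n) (downFrom-2* n)

hankelPer : ℕ → Bool
hankelPer n = per H (downFrom n) (downFrom n)

hankelPer⁺ : ℕ → Bool
hankelPer⁺ n = per (withOnesRow H) (onesRow∷ (downFrom n)) (downFrom (suc n))

Hᶜ⁺ : Maybe ℕ → ℕ → Bool
Hᶜ⁺ = withOnesRow Hᶜ

per-Hᶜ-evens-odds : ∀ xs ys → per Hᶜ (map (2 *_) xs) (map (suc ∘ (2 *_)) ys) ≡ per H xs ys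
per-Hᶜ-evens-odds = per-reindex (2 *_) (suc ∘ (2 *_)) Hᶜ-even-odd

per-Hᶜ-odds-evens : ∀ xs ys → per Hᶜ (map (suc ∘ (2 *_)) xs) (map (2 *_) ys) ≡ per H xs ys
per-Hᶜ-odds-evens = per-reindex (suc ∘ (2 *_)) (2 *_) Hᶜ-odd-even

per-Hᶜ⁺-evens-odds : ∀ xs ys →
  per Hᶜ⁺ (onesRow∷ (map (2 *_) xs)) (map (suc ∘ (2 *_)) ys) ≡ per (withOnesRow H) (onesRow∷ xs) ys
per-Hᶜ⁺-evens-odds = per-withOnesRow-reindex (2 *_) (suc ∘ (2 *_)) Hᶜ-even-odd

per-Hᶜ⁺-odds-evens : ∀ xs ys →
  per Hᶜ⁺ (onesRow∷ (map (suc ∘ (2 *_)) xs)) (map (2 *_) ys) ≡ per (withOnesRow H) (onesRow∷ xs) ys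
per-Hᶜ⁺-odds-evens = per-withOnesRow-reindex (suc ∘ (2 *_)) (2 *_) Hᶜ-odd-even

Hᶜ-evens-evens : ∀ m n → ZeroBlock Hᶜ (evens m) (evens n)
Hᶜ-evens-evens m n = ZeroBlock-map (2 *_) (2 *_) Hᶜ-even-even (downFrom m) (downFrom n)

Hᶜ-odds-odds : ∀ m n → ZeroBlock Hᶜ (odds m) (odds n)
Hᶜ-odds-odds m n = ZeroBlock-map (suc ∘ (2 *_)) (suc ∘ (2 *_)) Hᶜ-odd-odd (downFrom m) (downFrom n)

hankelPer⁺-split : ∀ {m e o} → downFrom m ↭ evens e ++ odds o → downFrom (suc m) ↭ odds e ++ evens (suc o) →
  hankelPer⁺ m ≡ hankelPer e ∧ hankelPer⁺ o
hankelPer⁺-split {m} {e} {o} rows↭ cols↭ = begin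
  hankelPer⁺ m
    ≡⟨ per-cong H⁺≡not-Hᶜ⁺ (onesRow∷ (downFrom m)) (downFrom (suc m)) ⟩
  per (withOnesRow (λ r c → not (Hᶜ r c))) (onesRow∷ (downFrom m)) (downFrom (suc m))
    ≡⟨ per-complement-onesRow Hᶜ (downFrom m) (downFrom (suc m)) ⟩
  per Hᶜ⁺ (onesRow∷ (downFrom m)) (downFrom (suc m))
    ≡⟨ per-↭ Hᶜ⁺ (↭.trans (↭.prep nothing (↭-map⁺ just rows↭)) (onesRow∷-++-↭ˡ (evens e) (odds o))) cols↭ ⟩
  per Hᶜ⁺ (map just (evens e) ++ onesRow∷ (odds o)) (odds e ++ evens (suc o))
    ≡⟨ per-block Hᶜ⁺ (map just (evens e)) (odds e) square (ZeroBlock-withOnesRow (Hᶜ-evens-evens e (suc o))) ⟩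
  per Hᶜ⁺ (map just (evens e)) (odds e) ∧ per Hᶜ⁺ (onesRow∷ (odds o)) (evens (suc o))
    ≡⟨ cong₂ _∧_ (trans (per-withOnesRow-just Hᶜ (evens e) (odds e)) (per-Hᶜ-evens-odds (downFrom e) (downFrom e)))
                 (per-Hᶜ⁺-odds-evens (downFrom o) (downFrom (suc o))) ⟩
  hankelPer e ∧ hankelPer⁺ o ∎
  where
  H⁺≡not-Hᶜ⁺ : ∀ x y → withOnesRow H x y ≡ withOnesRow (λ r c → not (Hᶜ r c)) x y
  H⁺≡not-Hᶜ⁺ nothing  y = refl
  H⁺≡not-Hᶜ⁺ (just x) y = H≡not-Hᶜ x y
  square : length (map just (evens e)) ≡ length (odds e)
  square = trans (length-map just (evens e)) (length-evens≡length-odds e)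

hankelPer⁺-2* : ∀ n → hankelPer⁺ (2 * n) ≡ hankelPer n ∧ hankelPer⁺ n
hankelPer⁺-2* n = hankelPer⁺-split {e = n} (downFrom-2* n) (↭.trans (downFrom-1+2* n) (++-comm (evens (suc n)) (odds n)))

hankelPer⁺-1+2* : ∀ n → hankelPer⁺ (suc (2 * n)) ≡ hankelPer (suc n) ∧ hankelPer⁺ n
hankelPer⁺-1+2* n = hankelPer⁺-split {e = suc n} (downFrom-1+2* n)
  (subst (λ m → downFrom m ↭ odds (suc n) ++ evens (suc n)) (*-suc 2 n)
    (↭.trans (downFrom-2* (suc n)) (++-comm (evens (suc n)) (odds (suc n)))))

hankelPer-expand : ∀ {m e o} → downFrom m ↭ evens e ++ odds o →
  hankelPer m ≡ per Hᶜ (evens e ++ odds o) (odds o ++ evens e) xor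
    ((⨁[ p ← select (evens e) ] per Hᶜ⁺ (onesRow∷ (proj₂ p ++ odds o)) (odds o ++ evens e)) xor
     (⨁[ q ← select (odds o) ] per Hᶜ⁺ (onesRow∷ (evens e ++ proj₂ q)) (odds o ++ evens e)))
hankelPer-expand {m} {e} {o} split = begin
  hankelPer m
    ≡⟨ per-↭ H split (↭.trans split (++-comm (evens e) (odds o))) ⟩
  per H (evens e ++ odds o) (odds o ++ evens e)
    ≡⟨ per-cong H≡not-Hᶜ (evens e ++ odds o) (odds o ++ evens e) ⟩
  per (λ r c → not (Hᶜ r c)) (evens e ++ odds o) (odds o ++ evens e)
    ≡⟨ per-complement Hᶜ (evens e ++ odds o) (odds o ++ evens e) ⟩
  per Hᶜ (evens e ++ odds o) (odds o ++ evens e) xor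
    (⨁[ q ← select (evens e ++ odds o) ] per Hᶜ⁺ (onesRow∷ (proj₂ q)) (odds o ++ evens e))
    ≡⟨ cong (per Hᶜ (evens e ++ odds o) (odds o ++ evens e) xor_)
            (xorSum-select-++ (evens e) (odds o) (λ q → per Hᶜ⁺ (onesRow∷ (proj₂ q)) (odds o ++ evens e))) ⟩
  _ ∎

odds<evens-suc : ∀ n → length (odds n) < length (evens (suc n))
odds<evens-suc n rewrite length-odds n | length-evens (suc n) = n<1+n n

onesRowSum : ℕ → Bool
onesRowSum n = ⨁[ p ← select (downFrom n) ] per (withOnesRow H) (onesRow∷ (proj₂ p)) (downFrom n)

per-Hᶜ-parityBlocks-2* : ∀ n → per Hᶜ (evens n ++ odds n) (odds n ++ evens n) ≡ hankelPer n ∧ hankelPer n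
per-Hᶜ-parityBlocks-2* n =
  trans (per-block Hᶜ (evens n) (odds n) (length-evens≡length-odds n) (Hᶜ-evens-evens n n))
        (cong₂ _∧_ (per-Hᶜ-evens-odds (downFrom n) (downFrom n)) (per-Hᶜ-odds-evens (downFrom n) (downFrom n)))

onesRow-among-evens-2* : ∀ n →
  (⨁[ p ← select (evens n) ] per Hᶜ⁺ (onesRow∷ (proj₂ p ++ odds n)) (odds n ++ evens n)) ≡ hankelPer n ∧ onesRowSum n
onesRow-among-evens-2* n = begin
  (⨁[ p ← select E ] per Hᶜ⁺ (onesRow∷ (proj₂ p ++ O)) (O ++ E))
    ≡⟨ xorSum-cong (select E) (λ p → trans
         (per-↭ Hᶜ⁺ (onesRow∷-++-↭ʳ (proj₂ p) O) (++-comm O E))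
         (per-block Hᶜ⁺ (map just O) E (trans (length-map just O) (sym (length-evens≡length-odds n)))
            (ZeroBlock-withOnesRow (Hᶜ-odds-odds n n)))) ⟩
  (⨁[ p ← select E ] (per Hᶜ⁺ (map just O) E ∧ per Hᶜ⁺ (onesRow∷ (proj₂ p)) O))
    ≡⟨ ∧-distribˡ-xorSum _ (select E) _ ⟨
  per Hᶜ⁺ (map just O) E ∧ (⨁[ p ← select E ] per Hᶜ⁺ (onesRow∷ (proj₂ p)) O)
    ≡⟨ cong₂ _∧_ (trans (per-withOnesRow-just Hᶜ O E) (per-Hᶜ-odds-evens (downFrom n) (downFrom n)))
                 (trans (xorSum-select-map (2 *_) (downFrom n) _)
                        (xorSum-cong (select (downFrom n)) λ p → per-Hᶜ⁺-evens-odds (proj₂ p) (downFrom n))) ⟩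
  hankelPer n ∧ onesRowSum n ∎
  where
  E O : List ℕ
  E = evens n
  O = odds n

onesRow-among-odds-2* : ∀ n →
  (⨁[ q ← select (odds n) ] per Hᶜ⁺ (onesRow∷ (evens n ++ proj₂ q)) (odds n ++ evens n)) ≡ hankelPer n ∧ onesRowSum n
onesRow-among-odds-2* n = begin
  (⨁[ q ← select O ] per Hᶜ⁺ (onesRow∷ (E ++ proj₂ q)) (O ++ E))
    ≡⟨ xorSum-cong (select O) (λ q → trans
         (per-↭-rows Hᶜ⁺ (onesRow∷-++-↭ˡ E (proj₂ q)) (O ++ E))
         (per-block Hᶜ⁺ (map just E) O (trans (length-map just E) (length-evens≡length-odds n))
            (ZeroBlock-withOnesRow (Hᶜ-evens-evens n n)))) ⟩
  (⨁[ q ← select O ] (per Hᶜ⁺ (map just E) O ∧ per Hᶜ⁺ (onesRow∷ (proj₂ q)) E))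
    ≡⟨ ∧-distribˡ-xorSum _ (select O) _ ⟨
  per Hᶜ⁺ (map just E) O ∧ (⨁[ q ← select O ] per Hᶜ⁺ (onesRow∷ (proj₂ q)) E)
    ≡⟨ cong₂ _∧_ (trans (per-withOnesRow-just Hᶜ E O) (per-Hᶜ-evens-odds (downFrom n) (downFrom n)))
                 (trans (xorSum-select-map (suc ∘ (2 *_)) (downFrom n) _)
                        (xorSum-cong (select (downFrom n)) λ q → per-Hᶜ⁺-odds-evens (proj₂ q) (downFrom n))) ⟩
  hankelPer n ∧ onesRowSum n ∎
  where
  E O : List ℕ
  E = evens n
  O = odds n

hankelPer-2* : ∀ n → hankelPer (2 * n) ≡ hankelPer n ∧ hankelPer n
hankelPer-2* n = begin
  hankelPer (2 * n)
    ≡⟨ trans (hankelPer-expand {e = n} {o = n} (downFrom-2* n))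
             (cong₂ _xor_ (per-Hᶜ-parityBlocks-2* n)
                          (cong₂ _xor_ (onesRow-among-evens-2* n) (onesRow-among-odds-2* n))) ⟩
  (h ∧ h) xor ((h ∧ s) xor (h ∧ s))  ≡⟨ cong ((h ∧ h) xor_) (xor-same (h ∧ s)) ⟩
  (h ∧ h) xor false                  ≡⟨ xor-identityʳ (h ∧ h) ⟩
  h ∧ h                              ∎
  where
  h s : Bool
  h = hankelPer n
  s = onesRowSum n

per-Hᶜ-parityBlocks-1+2* : ∀ n → per Hᶜ (evens (suc n) ++ odds n) (odds n ++ evens (suc n)) ≡ false
per-Hᶜ-parityBlocks-1+2* n =
  per-block-tall Hᶜ (evens (suc n)) (odds n) (odds<evens-suc n) (Hᶜ-evens-evens (suc n) (suc n))

onesRow-among-odds-1+2* : ∀ n →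
  (⨁[ q ← select (odds n) ] per Hᶜ⁺ (onesRow∷ (evens (suc n) ++ proj₂ q)) (odds n ++ evens (suc n))) ≡ false
onesRow-among-odds-1+2* n = xorSum-false (select (odds n)) λ q → trans
  (per-↭-rows Hᶜ⁺ (onesRow∷-++-↭ˡ (evens (suc n)) (proj₂ q)) (odds n ++ evens (suc n)))
  (per-block-tall Hᶜ⁺ (map just (evens (suc n))) (odds n)
    (subst (length (odds n) <_) (sym (length-map just (evens (suc n)))) (odds<evens-suc n))
    (ZeroBlock-withOnesRow (Hᶜ-evens-evens (suc n) (suc n))))

onesRow-among-evens-1+2* : ∀ n →
  (⨁[ p ← select (evens (suc n)) ] per Hᶜ⁺ (onesRow∷ (proj₂ p ++ odds n)) (odds n ++ evens (suc n)))
    ≡ hankelPer⁺ n ∧ hankelPer⁺ n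
onesRow-among-evens-1+2* n = begin
  (⨁[ p ← select E ] per Hᶜ⁺ (onesRow∷ (proj₂ p ++ O)) (O ++ E))
    ≡⟨ xorSum-congᴬ (All.zipWith (λ { {p} (p↭ , zero-block) → split p p↭ zero-block })
         (select-↭ E , All.map (λ { (_ ∷ rest) → rest }) (select-All (Hᶜ-evens-evens (suc n) (suc n))))) ⟩
  (⨁[ p ← select E ] (per Hᶜ (proj₂ p) O ∧ Z))
    ≡⟨ ∧-distribʳ-xorSum Z (select E) (λ p → per Hᶜ (proj₂ p) O) ⟨
  (⨁[ p ← select E ] per Hᶜ (proj₂ p) O) ∧ Z
    ≡⟨ cong (_∧ Z) columnSum ⟩
  Z ∧ Z
    ≡⟨ cong₂ _∧_ Z≡ Z≡ ⟩
  hankelPer⁺ n ∧ hankelPer⁺ n ∎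
  where
  E O : List ℕ
  E = evens (suc n)
  O = odds n
  Z : Bool
  Z = per Hᶜ⁺ (onesRow∷ O) E
  Z≡ : Z ≡ hankelPer⁺ n
  Z≡ = per-Hᶜ⁺-odds-evens (downFrom n) (downFrom (suc n))
  split : ∀ p → proj₁ p ∷ proj₂ p ↭ E → ZeroBlock Hᶜ (proj₂ p) E →
          per Hᶜ⁺ (onesRow∷ (proj₂ p ++ O)) (O ++ E) ≡ per Hᶜ (proj₂ p) O ∧ Z
  split p p↭ zero-block = begin
    per Hᶜ⁺ (onesRow∷ (proj₂ p ++ O)) (O ++ E)
      ≡⟨ per-↭-rows Hᶜ⁺ (onesRow∷-++-↭ˡ (proj₂ p) O) (O ++ E) ⟩
    per Hᶜ⁺ (map just (proj₂ p) ++ onesRow∷ O) (O ++ E)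
      ≡⟨ per-block Hᶜ⁺ (map just (proj₂ p)) O square (ZeroBlock-withOnesRow zero-block) ⟩
    per Hᶜ⁺ (map just (proj₂ p)) O ∧ Z
      ≡⟨ cong (_∧ Z) (per-withOnesRow-just Hᶜ (proj₂ p) O) ⟩
    per Hᶜ (proj₂ p) O ∧ Z ∎
    where
    square : length (map just (proj₂ p)) ≡ length O
    square = trans (length-map just (proj₂ p))
      (suc-injective (trans (↭-length p↭) (trans (length-evens (suc n)) (cong suc (sym (length-odds n))))))
  columnSum : (⨁[ p ← select E ] per Hᶜ (proj₂ p) O) ≡ Z
  columnSum = sym (trans (per-onesRow∷ Hᶜ O E) (xorSum-cong (select E) λ p →
    trans (per-transpose Hᶜ O (proj₂ p)) (per-cong (flip Hᶜ-comm) (proj₂ p) O)))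

hankelPer-1+2* : ∀ n → hankelPer (suc (2 * n)) ≡ hankelPer⁺ n ∧ hankelPer⁺ n
hankelPer-1+2* n = begin
  hankelPer (suc (2 * n))
    ≡⟨ trans (hankelPer-expand {e = suc n} {o = n} (downFrom-1+2* n))
             (cong₂ _xor_ (per-Hᶜ-parityBlocks-1+2* n)
                          (cong₂ _xor_ (onesRow-among-evens-1+2* n) (onesRow-among-odds-1+2* n))) ⟩
  false xor ((hankelPer⁺ n ∧ hankelPer⁺ n) xor false)
    ≡⟨ xor-identityʳ (hankelPer⁺ n ∧ hankelPer⁺ n) ⟩
  hankelPer⁺ n ∧ hankelPer⁺ n ∎

hankelPer-true : ∀ n → hankelPer n ≡ true × hankelPer⁺ n ≡ true
hankelPer-true = <-rec _ step
  where
  step : ∀ n → (∀ {m} → m < n → hankelPer m ≡ true × hankelPer⁺ m ≡ true) →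
         hankelPer n ≡ true × hankelPer⁺ n ≡ true
  step n rec with evenOdd n
  ... | even zero    = refl , refl
  ... | odd  zero    = refl , refl
  ... | even (suc k) =
    let h , h⁺ = rec (m<m+n (suc k) z<s) in
    trans (hankelPer-2* (suc k)) (cong₂ _∧_ h h) , trans (hankelPer⁺-2* (suc k)) (cong₂ _∧_ h h⁺)
  ... | odd  (suc k) =
    let h , h⁺ = rec (k<1+2k (suc k))
        g , _  = rec (s≤s (m<m+n (suc k) z<s)) in
    trans (hankelPer-1+2* (suc k)) (cong₂ _∧_ h⁺ h⁺) , trans (hankelPer⁺-1+2* (suc k)) (cong₂ _∧_ g h⁺)

tabulate-∘toℕ : ∀ n (f : ℕ → A) → tabulate {n = n} (f ∘ toℕ) ≡ applyUpTo f n
tabulate-∘toℕ zero    f = refl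
tabulate-∘toℕ (suc n) f = cong (f 0 ∷_) (tabulate-∘toℕ n (f ∘ suc))

map-toℕ-allFin : ∀ n → map toℕ (allFin n) ↭ downFrom n
map-toℕ-allFin n = ↭.trans (↭-reflexive (trans (map-tabulate {n = n} id toℕ) (tabulate-∘toℕ n id)))
                   (↭.trans (↭-sym (↭-reverse (upTo n))) (↭-reflexive (reverse-upTo n)))

per-H-allFin : ∀ n → per (λ i j → H (toℕ i) (toℕ j)) (allFin n) (allFin n) ≡ hankelPer n
per-H-allFin n = trans (sym (per-reindex toℕ toℕ (λ _ _ → refl) (allFin n) (allFin n)))
                       (per-↭ H (map-toℕ-allFin n) (map-toℕ-allFin n))

-- Row x < m of the matrix is row x of H; the unconstrained row m is the all-ones row.
rowIndex : ℕ → ℕ → Maybe ℕ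
rowIndex m x with x <? m
... | yes _ = just x
... | no  _ = nothing

rowIndex-< : ∀ {m x} → x < m → rowIndex m x ≡ just x
rowIndex-< {m} {x} x<m with x <? m
... | yes _   = refl
... | no  x≮m = ⊥-elim (x≮m x<m)

rowIndex-self : ∀ m → rowIndex m m ≡ nothing
rowIndex-self m with m <? m
... | yes m<m = ⊥-elim (<-irrefl refl m<m)
... | no  _   = refl

rowIndex⇒J : ∀ m x y → withOnesRow H (rowIndex m x) y ≡ true → x < m → J (x + y)
rowIndex⇒J m x y H⁺≡true x<m with x <? m
... | yes _   = inJ⇒J (x + y) H⁺≡true
... | no  x≮m = ⊥-elim (x≮m x<m)

J⇒rowIndex : ∀ m x y → (x < m → J (x + y)) → withOnesRow H (rowIndex m x) y ≡ true
J⇒rowIndex m x y J[x+y] with x <? m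
... | yes x<m = J⇒inJ (x + y) (J[x+y] x<m)
... | no  _   = refl

map-rowIndex-downFrom : ∀ m → map (rowIndex m) (downFrom (suc m)) ≡ onesRow∷ (downFrom m)
map-rowIndex-downFrom m = cong₂ _∷_ (rowIndex-self m)
  (map-cong-local (All.tabulate λ x∈ → rowIndex-< (∈-downFrom⁻ x∈)))

per-H⁺-allFin : ∀ m →
  per (λ i j → withOnesRow H (rowIndex m (toℕ i)) (toℕ j)) (allFin (suc m)) (allFin (suc m)) ≡ hankelPer⁺ m
per-H⁺-allFin m =
  trans (sym (per-reindex {R = withOnesRow H} (rowIndex m ∘ toℕ) toℕ (λ _ _ → refl) (allFin (suc m)) (allFin (suc m))))
        (per-↭ (withOnesRow H) rows (map-toℕ-allFin (suc m)))
  where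
  rows : map (rowIndex m ∘ toℕ) (allFin (suc m)) ↭ onesRow∷ (downFrom m)
  rows = subst (_↭ onesRow∷ (downFrom m)) (sym (map-∘ (allFin (suc m))))
    (↭.trans (↭-map⁺ (rowIndex m) (map-toℕ-allFin (suc m))) (↭-reflexive (map-rowIndex-downFrom m)))

theoremJ : ((m : ℕ) → 1 ≤ m →
    ∃ λ N → Odd N × CountIs m (λ σ → IsPerm m σ × ((i : Fin m) → J (toℕ i + toℕ (σ i)))) N)
    ×
    ((m : ℕ) → 1 ≤ m →
    ∃ λ N → Odd N × CountIs m (λ σ → IsPerm m σ × ((i : Fin m) → toℕ i < m ∸ 1 → J (toℕ i + toℕ (σ i)))) N)
theoremJ =
  (λ { (suc m) _ → oddly-many-matchings m (λ i j → H (toℕ i) (toℕ j)) _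
                     (λ {i} {j} → inJ⇒J (toℕ i + toℕ j)) (λ {i} {j} → J⇒inJ (toℕ i + toℕ j))
                     (trans (per-H-allFin (suc m)) (proj₁ (hankelPer-true (suc m)))) }) ,
  (λ { (suc m) _ → oddly-many-matchings m (λ i j → withOnesRow H (rowIndex m (toℕ i)) (toℕ j)) _
                     (λ {i} {j} → rowIndex⇒J m (toℕ i) (toℕ j)) (λ {i} {j} → J⇒rowIndex m (toℕ i) (toℕ j))
                     (trans (per-H⁺-allFin m) (proj₂ (hankelPer-true m))) })
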